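{- For every integer $k\geq 2$ and every $0<\delta\leq 1$ we have $\mathrm{DHJ}(k,\delta)\leq \mathrm{DCS}(k,1,\delta)$.
   Context: $[k]=\{1,\dots,k\}$; $[k]^n$ is the set of words (finite sequences) of length $n$ over $[k]$, $[k]^{<\mathbb{N}}$ all words, $^{\frown}$ concatenation. A variable word over $k$ is a finite sequence over $[k]\cup\{v\}$ ($v$ a variable letter) in which $v$ occurs; $w(a)$ replaces every $v$ by $a$; a left variable word has first letter $v$. A combinatorial line of $[k]^n$ is a set $\{w(a):a\in[k]\}$ with $w$ a variable word of length $n$. A Carlson--Simpson line of $[k]^{<\mathbb{N}}$ is a set $\{c\}\cup\{c^{\frown}w(a):a\in[k]\}$ with $c$ a word and $w$ a left variable word. $\mathrm{DHJ}(k,\delta)$ is the least integer $N$ such that for every $n\ge N$ every $A\subseteq[k]^n$ with $|A|\ge\delta k^n$ contains a combinatorial line (it exists by the density Hales--Jewett theorem). $\mathrm{DCS}(k,1,\delta)$ is the least integer $N$ such that for every finite $L\subseteq\mathbb{N}$ with $|L|\ge N$ and every $A\subseteq[k]^{<\mathbb{N}}$ with $|A\cap[k]^n|\ge\delta k^n$ for all $n\in L$, $A$ contains a Carlson--Simpson line (such $N$ exists). -}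

module Defs where

open import Level using (0ℓ)
open import Data.Nat as ℕ using (ℕ; zero; suc; _^_)
open import Data.Integer using (+_)
open import Data.Rational as ℚ using (ℚ; 0ℚ; 1ℚ)
open import Data.Bool using (Bool; true; false)
open import Data.Fin using (Fin)
open import Data.Maybe using (Maybe; just; nothing; fromMaybe)
open import Data.List as List using (List; []; _∷_; length; concatMap; filter)
open import Data.List.Membership.Propositional using (_∈_)
open import Data.List.Relation.Unary.Unique.Propositional using (Unique)
open import Data.Vec as Vec using (Vec; []; _∷_; _++_)
open import Data.Vec.Relation.Unary.Any using (Any)
open import Data.Fin.Base using () renaming (zero to fz)
open import Data.List.Base using (allFin)
open import Data.Product using (Σ; ∃; _×_; _,_)
open import Relation.Binary.PropositionalEquality using (_≡_)
open import Relation.Nullary using (Dec)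
open import Data.Bool using (T)
open import Relation.Nullary.Decidable using (T?)

-- A real number δ with 0 < δ ≤ 1, represented by its (open) lower
-- Dedekind cut L = {q ∈ ℚ | q < δ}.
record Real01 : Set₁ where
  field
    L       : ℚ → Set
    lower   : ∀ {p q} → p ℚ.≤ q → L q → L p
    rounded : ∀ {q} → L q → Σ ℚ λ r → (q ℚ.< r) × L r
    pos     : L 0ℚ                       -- 0 < δ
    atMost1 : ∀ {q} → L q → q ℚ.< 1ℚ     -- δ ≤ 1
open Real01 public

ℕ→ℚ : ℕ → ℚ
ℕ→ℚ n = (+ n) ℚ./ 1

-- "m ≥ δ · k^n"  (m, k, n naturals):  every rational q < δ has q · k^n ≤ m
AtLeastDensity : Real01 → (k n m : ℕ) → Set
AtLeastDensity δ k n m = ∀ q → L δ q → q ℚ.* ℕ→ℚ (k ^ n) ℚ.≤ ℕ→ℚ m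

-- All words of length n over [k] (letters are Fin k, i.e. 0..k-1 ~ 1..k)
allWords : (k n : ℕ) → List (Vec (Fin k) n)
allWords k zero    = [] ∷ []
allWords k (suc n) = concatMap (λ a → List.map (a ∷_) (allWords k n)) (allFin k)

card : ∀ {k n} → (Vec (Fin k) n → Bool) → ℕ
card {k} {n} A = length (filter (λ w → T? (A w)) (allWords k n))

-- Variable words: `nothing` is the variable letter v
VarWord : ℕ → ℕ → Set
VarWord k n = Vec (Maybe (Fin k)) n

IsVariable : ∀ {k n} → VarWord k n → Set
IsVariable w = Any (λ x → x ≡ nothing) w

subst : ∀ {k n} → VarWord k n → Fin k → Vec (Fin k) n
subst w a = Vec.map (fromMaybe a) w

HasCombLine : ∀ {k n} → (Vec (Fin k) n → Bool) → Set
HasCombLine {k} {n} A =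
  Σ (VarWord k n) λ w → IsVariable w × (∀ a → A (subst w a) ≡ true)

-- Subsets of [k]^{<ℕ} are given levelwise by indicator functions.
-- A contains a Carlson–Simpson line {c} ∪ {c ⁀ w(a) : a ∈ [k]} with w a
-- left variable word (first letter v), i.e. w = v ∷ w'.
HasCSLine : ∀ {k} → ((m : ℕ) → Vec (Fin k) m → Bool) → Set
HasCSLine {k} A =
  Σ ℕ λ m → Σ (Vec (Fin k) m) λ c → Σ ℕ λ l → Σ (VarWord k l) λ w' →
    (A m c ≡ true) × (∀ a → A (m ℕ.+ suc l) (c ++ subst (nothing ∷ w') a) ≡ true)

DHJProp : (k : ℕ) → Real01 → ℕ → Set
DHJProp k δ N = ∀ n → N ℕ.≤ n → (A : Vec (Fin k) n → Bool) →
  AtLeastDensity δ k n (card A) → HasCombLine A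

-- N has the defining property of DCS(k,1,δ); the finite set L ⊆ ℕ is a
-- duplicate-free list
DCSProp : (k : ℕ) → Real01 → ℕ → Set
DCSProp k δ N = (Ls : List ℕ) → Unique Ls → N ℕ.≤ length Ls →
  (A : (m : ℕ) → Vec (Fin k) m → Bool) →
  (∀ n → n ∈ Ls → AtLeastDensity δ k n (card (A n))) → HasCSLine A

IsLeast : (ℕ → Set) → ℕ → Set
IsLeast P N = P N × (∀ M → P M → N ℕ.≤ M)

module Submission where

-- Let M have the DCS property and let A ⊆ [k]^n be δ-dense with n ≥ M.  For
-- every level m ≤ n, averaging over the prefixes z ∈ [k]^(n-m) yields a
-- prefix whose section A_z = {x ∈ [k]^m : z⁀x ∈ A} is still δ-dense.  These
-- sections, for m = 0,…,n, form one set B ⊆ [k]^{<ℕ} (empty above level n)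
-- which is δ-dense on n+1 ≥ M levels, so B contains a Carlson–Simpson line.
-- Its points c⁀w(a) form a combinatorial line inside one section A_z, and
-- prefixing z turns it into a combinatorial line of A.  So M has the DHJ
-- property, and N ≤ M because N is the least number with that property.

open import Defs

open import Algebra.Bundles using (CommutativeMonoid)
import Algebra.Properties.CommutativeSemigroup as CommSemigroupProperties
open import Data.Bool using (Bool; true; false)
open import Data.Empty using (⊥-elim)
open import Data.Fin using (Fin)
import Data.Integer as ℤ
import Data.Integer.Properties as ℤP
open import Data.List as List using (List; []; _∷_; length; filter; concatMap; allFin; upTo)
import Data.List.Extrema.Nat as Extrema
import Data.List.Properties as ListP
open import Data.List.Relation.Unary.All as All using (All; []; _∷_)
import Data.List.Membership.Propositional.Properties as MembershipP
import Data.List.Relation.Unary.Unique.Propositional.Properties as UniqueP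
open import Data.Maybe using (just; nothing)
open import Data.Nat as ℕ using (ℕ; suc; _+_; _*_; _^_; _∸_; _≤_; _≤?_; z≤n; NonZero)
open import Data.Nat.ListAction using (sum)
import Data.Nat.Coprimality as Coprime
import Data.Nat.Properties as ℕP
open import Data.Product using (Σ; _,_; proj₁; proj₂)
open import Data.Rational as ℚ using (mkℚ)
import Data.Rational.Properties as ℚP
import Data.Rational.Unnormalised as ℚᵘ
import Data.Rational.Unnormalised.Properties as ℚᵘP
open import Data.Vec as Vec using (Vec; []; _∷_; _++_)
open import Data.Vec.Relation.Unary.Any using (here)
import Data.Vec.Relation.Unary.Any.Properties as AnyP
open import Relation.Binary.PropositionalEquality using (_≡_; _≢_; refl; sym; trans; cong; cong₂; module ≡-Reasoning)
open import Relation.Nullary using (yes; no)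
open import Relation.Nullary.Decidable using (T?)

ℕ→ℚ-normal : ∀ n → ℕ→ℚ n ≡ mkℚ (ℤ.+ n) 0 (Coprime.sym (Coprime.1-coprimeTo n))
ℕ→ℚ-normal n = ℚP.normalize-coprime (Coprime.sym (Coprime.1-coprimeTo n))

ℕ→ℚ-* : ∀ a b → ℕ→ℚ (a * b) ≡ ℕ→ℚ a ℚ.* ℕ→ℚ b
ℕ→ℚ-* a b = ℚP.toℚᵘ-injective (ℚᵘP.≃-trans (ℚᵘP.≃-reflexive representatives)
                                            (ℚᵘP.≃-sym (ℚP.toℚᵘ-homo-* (ℕ→ℚ a) (ℕ→ℚ b))))
  where
  toℚᵘ-ℕ→ℚ : ∀ n → ℚ.toℚᵘ (ℕ→ℚ n) ≡ ℚᵘ.mkℚᵘ (ℤ.+ n) 0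
  toℚᵘ-ℕ→ℚ n = cong ℚ.toℚᵘ (ℕ→ℚ-normal n)

  representatives : ℚ.toℚᵘ (ℕ→ℚ (a * b)) ≡ ℚ.toℚᵘ (ℕ→ℚ a) ℚᵘ.* ℚ.toℚᵘ (ℕ→ℚ b)
  representatives = begin
    ℚ.toℚᵘ (ℕ→ℚ (a * b))                  ≡⟨ toℚᵘ-ℕ→ℚ (a * b) ⟩
    ℚᵘ.mkℚᵘ (ℤ.+ (a * b)) 0               ≡⟨ cong (λ z → ℚᵘ.mkℚᵘ z 0) (ℤP.pos-* a b) ⟩
    ℚᵘ.mkℚᵘ (ℤ.+ a ℤ.* ℤ.+ b) 0           ≡⟨ cong₂ ℚᵘ._*_ (sym (toℚᵘ-ℕ→ℚ a)) (sym (toℚᵘ-ℕ→ℚ b)) ⟩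
    ℚ.toℚᵘ (ℕ→ℚ a) ℚᵘ.* ℚ.toℚᵘ (ℕ→ℚ b)  ∎
    where open ≡-Reasoning

ℕ→ℚ-mono : ∀ {a b} → a ≤ b → ℕ→ℚ a ℚ.≤ ℕ→ℚ b
ℕ→ℚ-mono {a} {b} a≤b rewrite ℕ→ℚ-normal a | ℕ→ℚ-normal b =
  ℚ.*≤* (ℤP.*-monoʳ-≤-nonNeg (ℤ.+ 1) (ℤ.+≤+ a≤b))

ℕ→ℚ-pos : ∀ n .{{_ : NonZero n}} → ℚ.Positive (ℕ→ℚ n)
ℕ→ℚ-pos (suc n) = ℚP.normalize-pos (suc n) 1

-- Density transfer: if c ≥ δ·k^(r+m) and c ≤ k^r·C, then C ≥ δ·k^m.
-- This is how density survives passing from A to its best section.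
density-transfer : ∀ δ k r m {c C} .{{_ : NonZero k}} →
  AtLeastDensity δ k (r + m) c → c ≤ k ^ r * C → AtLeastDensity δ k m C
density-transfer δ k r m {c} {C} c-dense c≤ q q<δ =
  ℚP.*-cancelˡ-≤-pos K {{ℕ→ℚ-pos (k ^ r) {{ℕP.m^n≢0 k r}}}} (begin
    K ℚ.* (q ℚ.* ℕ→ℚ (k ^ m))     ≡⟨ x∙yz≈y∙xz K q (ℕ→ℚ (k ^ m)) ⟩
    q ℚ.* (K ℚ.* ℕ→ℚ (k ^ m))     ≡⟨ cong (q ℚ.*_) (sym (ℕ→ℚ-* (k ^ r) (k ^ m))) ⟩
    q ℚ.* ℕ→ℚ (k ^ r * k ^ m)     ≡⟨ cong (λ t → q ℚ.* ℕ→ℚ t) (sym (ℕP.^-distribˡ-+-* k r m)) ⟩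
    q ℚ.* ℕ→ℚ (k ^ (r + m))       ≤⟨ c-dense q q<δ ⟩
    ℕ→ℚ c                         ≤⟨ ℕ→ℚ-mono c≤ ⟩
    ℕ→ℚ (k ^ r * C)               ≡⟨ ℕ→ℚ-* (k ^ r) C ⟩
    K ℚ.* ℕ→ℚ C                   ∎)
  where
  open ℚP.≤-Reasoning
  open CommSemigroupProperties (CommutativeMonoid.commutativeSemigroup ℚP.*-1-commutativeMonoid)
  K = ℕ→ℚ (k ^ r)

count : ∀ {k n} → (Vec (Fin k) n → Bool) → List (Vec (Fin k) n) → ℕ
count A xs = length (filter (λ w → T? (A w)) xs)

count-++ : ∀ {k n} (A : Vec (Fin k) n → Bool) xs ys →
  count A (xs List.++ ys) ≡ count A xs + count A ys
count-++ A [] ys = refl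
count-++ A (x ∷ xs) ys with A x
... | true  = cong suc (count-++ A xs ys)
... | false = count-++ A xs ys

count-map : ∀ {k m n} (A : Vec (Fin k) n → Bool) (h : Vec (Fin k) m → Vec (Fin k) n) xs →
  count A (List.map h xs) ≡ count (λ x → A (h x)) xs
count-map A h [] = refl
count-map A h (x ∷ xs) with A (h x)
... | true  = cong suc (count-map A h xs)
... | false = count-map A h xs

count-concatMap : ∀ {k n} {X : Set} (A : Vec (Fin k) n → Bool) (f : X → List (Vec (Fin k) n)) xs →
  count A (concatMap f xs) ≡ sum (List.map (λ x → count A (f x)) xs)
count-concatMap A f [] = refl
count-concatMap A f (x ∷ xs) =
  trans (count-++ A (f x) (concatMap f xs)) (cong (count A (f x) +_) (count-concatMap A f xs))

card-by-first-letter : ∀ {k n} (A : Vec (Fin k) (suc n) → Bool) →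
  card A ≡ sum (List.map (λ a → card (λ y → A (a ∷ y))) (allFin k))
card-by-first-letter {k} {n} A =
  trans (count-concatMap A (λ a → List.map (a ∷_) (allWords k n)) (allFin k))
        (cong sum (ListP.map-cong (λ a → count-map A (a ∷_) (allWords k n)) (allFin k)))

sum-bounded : {X : Set} (f : X → ℕ) {b : ℕ} {xs : List X} →
  All (λ x → f x ≤ b) xs → sum (List.map f xs) ≤ length xs * b
sum-bounded f []            = z≤n
sum-bounded f (fx≤b ∷ rest) = ℕP.+-mono-≤ fx≤b (sum-bounded f rest)

section : ∀ {k r m} → (Vec (Fin k) (r + m) → Bool) → Vec (Fin k) r → Vec (Fin k) m → Bool
section A z x = A (z ++ x)

-- Induction on r: take for every first letter a
-- the best continuation z_a, then the letter a whose section A_{a z_a} is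
-- largest.
averaging : ∀ {k m} (a₀ : Fin k) r (A : Vec (Fin k) (r + m) → Bool) →
  Σ (Vec (Fin k) r) λ z → card A ≤ k ^ r * card (section A z)
averaging a₀ ℕ.zero A = [] , ℕP.≤-reflexive (sym (ℕP.+-identityʳ (card A)))
averaging {k} a₀ (suc r) A = (best ∷ continuation best) , bound
  where
  continuation : Fin k → Vec (Fin k) r
  continuation a = proj₁ (averaging a₀ r (λ y → A (a ∷ y)))

  size : Fin k → ℕ
  size a = card (section A (a ∷ continuation a))

  best : Fin k
  best = Extrema.argmax size a₀ (allFin k)

  letter-bound : ∀ a → card (λ y → A (a ∷ y)) ≤ k ^ r * size best
  letter-bound a = ℕP.≤-trans (proj₂ (averaging a₀ r (λ y → A (a ∷ y))))
                              (ℕP.*-monoʳ-≤ (k ^ r) (size≤best a))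
    where
    size≤best : ∀ a → size a ≤ size best
    size≤best a = All.lookup (Extrema.f[xs]≤f[argmax] {f = size} a₀ (allFin k))
                             (MembershipP.∈-allFin a)

  bound : card A ≤ k ^ suc r * size best
  bound = begin
    card A                                                  ≡⟨ card-by-first-letter A ⟩
    sum (List.map (λ a → card (λ y → A (a ∷ y))) (allFin k)) ≤⟨ sum-bounded _ {xs = allFin k} (All.tabulate (λ {a} _ → letter-bound a)) ⟩
    length (allFin k) * (k ^ r * size best)                 ≡⟨ cong (_* (k ^ r * size best)) (ListP.length-tabulate {n = k} (λ i → i)) ⟩
    k * (k ^ r * size best)                                 ≡⟨ ℕP.*-assoc k (k ^ r) (size best) ⟨
    k ^ suc r * size best                                   ∎
    where open ℕP.≤-Reasoning

subst-prefix : ∀ {k m l} (z : Vec (Fin k) m) (v : VarWord k l) a →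
  subst (Vec.map just z ++ v) a ≡ z ++ subst v a
subst-prefix []      v a = refl
subst-prefix (x ∷ z) v a = cong (x ∷_) (subst-prefix z v a)

lift-line : ∀ {k r m} (A : Vec (Fin k) (r + m) → Bool) (z : Vec (Fin k) r) →
  HasCombLine (section A z) → HasCombLine A
lift-line A z (v , v-variable , v-in-A_z) =
  Vec.map just z ++ v , AnyP.++⁺ʳ (Vec.map just z) v-variable ,
  λ a → trans (cong A (subst-prefix z v a)) (v-in-A_z a)

cs-line⇒comb-line : ∀ {k} (A : (m : ℕ) → Vec (Fin k) m → Bool) →
  HasCSLine A → Σ ℕ λ p → HasCombLine (A p)
cs-line⇒comb-line A (m , c , l , w′ , _ , line-in-A) =
  m + suc l ,
  Vec.map just c ++ (nothing ∷ w′) , AnyP.++⁺ʳ (Vec.map just c) (here refl) ,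
  λ a → trans (cong (A (m + suc l)) (subst-prefix c (nothing ∷ w′) a)) (line-in-A a)

module Sections {k : ℕ} (δ : Real01) {n : ℕ} (A : Vec (Fin (suc k)) n → Bool) where

  -- The alphabet is nonempty; averaging needs a default letter.
  a₀ : Fin (suc k)
  a₀ = Fin.zero

  bestSection : ∀ r {m} → r + m ≡ n → Vec (Fin (suc k)) m → Bool
  bestSection r refl = section A (proj₁ (averaging a₀ r A))

  bestSection-dense : ∀ r {m} (e : r + m ≡ n) →
    AtLeastDensity δ (suc k) n (card A) → AtLeastDensity δ (suc k) m (card (bestSection r e))
  bestSection-dense r {m} refl A-dense =
    density-transfer δ (suc k) r m A-dense (proj₂ (averaging a₀ r A))

  bestSection-line : ∀ r {m} (e : r + m ≡ n) → HasCombLine (bestSection r e) → HasCombLine A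
  bestSection-line r refl = lift-line A (proj₁ (averaging a₀ r A))

  B : (m : ℕ) → Vec (Fin (suc k)) m → Bool
  B m with m ≤? n
  ... | yes m≤n = bestSection (n ∸ m) (ℕP.m∸n+n≡m m≤n)
  ... | no _    = λ _ → false

  B-dense : ∀ m → m ≤ n →
    AtLeastDensity δ (suc k) n (card A) → AtLeastDensity δ (suc k) m (card (B m))
  B-dense m m≤n with m ≤? n
  ... | yes m≤n′ = bestSection-dense (n ∸ m) (ℕP.m∸n+n≡m m≤n′)
  ... | no m≰n   = ⊥-elim (m≰n m≤n)

  B-line : ∀ p → HasCombLine (B p) → HasCombLine A
  B-line p with p ≤? n
  ... | yes p≤n = bestSection-line (n ∸ p) (ℕP.m∸n+n≡m p≤n)
  ... | no _    = λ (_ , _ , in-B) → ⊥-elim (empty (in-B a₀))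
    where
    empty : false ≢ true
    empty ()

dcs⇒dhj : ∀ k δ M → DCSProp (suc k) δ M → DHJProp (suc k) δ M
dcs⇒dhj k δ M dcs n M≤n A A-dense =
  let p , line = cs-line⇒comb-line B cs-line in B-line p line
  where
  open Sections δ A

  enough-levels : M ≤ length (upTo (suc n))
  enough-levels = ℕP.≤-trans M≤n (ℕP.≤-trans (ℕP.n≤1+n n) (ℕP.≤-reflexive (sym (ListP.length-upTo (suc n)))))

  cs-line : HasCSLine B
  cs-line = dcs (upTo (suc n)) (UniqueP.upTo⁺ (suc n)) enough-levels B
                (λ m m∈ → B-dense m (ℕP.≤-pred (MembershipP.∈-upTo⁻ m∈)) A-dense)

proposition11p13 : (k : ℕ) → 2 ≤ k → (δ : Real01) → (N M : ℕ) →
    IsLeast (DHJProp k δ) N → IsLeast (DCSProp k δ) M → N ≤ M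
proposition11p13 (suc k) _ δ N M (_ , N-least) (M-dcs , _) = N-least M (dcs⇒dhj k δ M M-dcs)
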